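{- Let $\succ$ be a complete strict social rule on $X$ with irreducible components $\mathcal T_1,\dots,\mathcal T_r$ and maximal component $\mathcal T_{\max}=\mathcal T_r$, and let $z$ be a u-local optimum. Then: (i) for each social outcome $x\in\mathcal T_i$ with $\mathcal T_i\ne\mathcal T_{\max}$, there exist an objects scheme $A_x$ with $\Phi(z,A_x)=\emptyset$ and a domination path through $A_x$ from $x$ to a social outcome $y\in\mathcal T_i$ that is lifting with respect to $A_x$; (ii) for each social outcome $x\in\mathcal T_i$ with $\mathcal T_i\neq\mathcal T_{\max}$, every domination path through an objects scheme $A$ with $\Phi(z,A)=\emptyset$ from $x$ to $z$ contains a social outcome $y\in\mathcal T_i$ that is lifting with respect to $A$; (iii) each $\mathcal T_i$ different from $\mathcal T_{\max}$ contains a social outcome that is lifting with respect to some objects scheme $A$ with $\Phi(z,A)=\emptyset$.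
   Context: Fix $n\ge1$ and positive integers $m_1,\dots,m_n$; social outcomes are $n$-tuples $x$ with $0\le x_i<m_i$, forming $X$. A complete strict social rule $\succ$ on $X$: for distinct $x,y$ exactly one of $x\succ y$, $y\succ x$ (not necessarily transitive); view it as a tournament with an arc $x\to y$ when $x\succ y$. The irreducible components are the maximal sub-tournaments in which every two nodes lie on a common directed cycle; they partition $X$ and are indexed $\mathcal T_1,\dots,\mathcal T_r$ so that for $i>j$ every node of $\mathcal T_i$ dominates every node of $\mathcal T_j$. An object is a nonempty $I\subseteq\{1,\dots,n\}$; an objects scheme is a finite set $A$ of objects with union $\{1,\dots,n\}$. $\Phi(x,I)=\{y: y\succ x,\ y_k=x_k\ \forall k\notin I\}$, $\Phi(x,A)=\bigcup_{I\in A}\Phi(x,I)$; $B(x,I)$ is the set of $y\in\Phi(x,I)$ with $y\succ w$ for all $w\in\Phi(x,I)\setminus\{y\}$. $x$ is a local optimum for $A$ if $\Phi(x,A)=\emptyset$. A domination path through $A$ from $x$ to $y$ is a sequence $x=x_0,\dots,x_s=y$ ($s\ge0$) with, for each $i\ge1$, some $I\in A$ with $x_i\in B(x_{i-1},I)$. $\Psi(z,A)$ is the set of $x$ such that $z$ is a local optimum for $A$ and a domination path through $A$ from $x$ to $z$ exists; $\Psi(z)=\bigcup_A\Psi(z,A)$ over all objects schemes; $z$ is a u-local optimum if $\Psi(z)=X$. A social outcome $x\in\mathcal T_i$ is lifting with respect to $A$ if there is $I\in A$ such that the element $y\in B(x,I)$ lies in some $\mathcal T_j$ with $j>i$. -}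

module Defs where

open import Data.Nat using (ℕ)
open import Data.Bool using (Bool; true; false)
open import Data.Fin using (Fin; zero; suc)
open import Data.Vec using (Vec; []; _∷_; lookup)
open import Data.Unit using (⊤)
open import Data.Product using (_×_; _,_; ∃; Σ)
open import Data.Sum using (_⊎_)
open import Data.List using (List)
import Data.List.Membership.Propositional as L
import Data.Fin.Subset as S
open import Relation.Nullary using (¬_)
open import Relation.Binary.PropositionalEquality using (_≡_; _≢_)

Out : ∀ {n} → Vec ℕ n → Set
Out []       = ⊤
Out (k ∷ ms) = Fin k × Out ms

coord : ∀ {n} {ms : Vec ℕ n} → Out ms → (i : Fin n) → Fin (lookup ms i)
coord {ms = k ∷ ms} (a , _)  zero    = a
coord {ms = k ∷ ms} (_ , xs) (suc i) = coord xs i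

Object : ℕ → Set
Object n = S.Subset n

record IsScheme {n : ℕ} (A : List (Object n)) : Set where
  field
    nonempty : ∀ {I} → I L.∈ A → S.Nonempty I
    covers   : ∀ (k : Fin n) → ∃ λ I → I L.∈ A × k S.∈ I

module Rule {n : ℕ} (ms : Vec ℕ n) (R : Out ms → Out ms → Bool) where

  X : Set
  X = Out ms

  _≻_ : X → X → Set
  x ≻ y = R x y ≡ true

  record CompleteStrict : Set where
    field
      irrefl   : ∀ x → ¬ (x ≻ x)
      total    : ∀ x y → x ≢ y → (x ≻ y) ⊎ (y ≻ x)
      asym     : ∀ x y → x ≻ y → ¬ (y ≻ x)

  data Reach : X → X → Set where
    arc  : ∀ {x y} → x ≻ y → Reach x y
    _◅_  : ∀ {x y w} → x ≻ y → Reach y w → Reach x w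

  SameComp : X → X → Set
  SameComp x y = x ≡ y ⊎ (Reach x y × Reach y x)

  -- the component of y has larger index than the component of x
  -- (every node of y's component dominates every node of x's component)
  Higher : X → X → Set
  Higher y x = ¬ SameComp y x × (∀ u v → SameComp u y → SameComp v x → u ≻ v)

  -- the component of x is not the maximal component T_max
  NotMax : X → Set
  NotMax x = ∃ λ w → Higher w x

  AgreeOutside : Object n → X → X → Set
  AgreeOutside I y x = ∀ k → k S.∉ I → coord y k ≡ coord x k

  InΦ : X → Object n → X → Set
  InΦ x I y = y ≻ x × AgreeOutside I y x

  InΦA : X → List (Object n) → X → Set
  InΦA x A y = ∃ λ I → I L.∈ A × InΦ x I y

  LocalOpt : List (Object n) → X → Set
  LocalOpt A x = ∀ y → ¬ InΦA x A y

  InB : X → Object n → X → Set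
  InB x I y = InΦ x I y × (∀ w → InΦ x I w → w ≢ y → y ≻ w)

  data DomPath (A : List (Object n)) : X → X → Set where
    here : ∀ {x} → DomPath A x x
    step : ∀ {x y w} (I : Object n) → I L.∈ A → InB x I y → DomPath A y w → DomPath A x w

  data OnPath {A : List (Object n)} (y : X) : ∀ {x w} → DomPath A x w → Set where
    at-start : ∀ {w} {p : DomPath A y w} → OnPath y p
    later    : ∀ {x x' w} {I} {I∈ : I L.∈ A} {b : InB x I x'} {p : DomPath A x' w}
               → OnPath y p → OnPath y (step I I∈ b p)

  InΨA : X → List (Object n) → X → Set
  InΨA z A x = LocalOpt A z × DomPath A x z

  ULocalOpt : X → Set
  ULocalOpt z = ∀ x → ∃ λ A → IsScheme A × InΨA z A x

  Lifting : List (Object n) → X → Set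
  Lifting A x = ∃ λ I → I L.∈ A × ∃ λ y → InB x I y × Higher y x

-- The arcs of a domination path all point upwards, so a domination path from x to z
-- climbs through the irreducible components.  A u-local optimum z is reached from
-- every outcome, hence reaches back to every outcome, so it lies in the maximal
-- component.  A path from x (in a non-maximal component) to z must therefore leave the
-- component of x, and the outcome it leaves from is lifting: in a tournament every arc
-- between two different components goes from the higher one to the lower one.
module Submission where

open import Defs
open import Level using (Level; _⊔_)
open import Data.Nat using (ℕ; _≤_)
open import Data.Bool using (Bool; true; _≟_)
open import Data.Fin using (Fin)
import Data.Fin as Fin
open import Data.Vec using (Vec; lookup; []; _∷_)
open import Data.List using (List; allFin; cartesianProduct) renaming ([] to []ₗ; _∷_ to _∷ₗ_)
open import Data.List.Relation.Unary.Any using (here; there)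
open import Data.List.Membership.Propositional using (_∈_)
open import Data.List.Membership.Propositional.Properties using (∈-cartesianProduct⁺; ∈-allFin)
open import Data.Product using (_×_; ∃; _,_)
open import Data.Product.Properties using (≡-dec)
open import Data.Sum using (_⊎_; inj₁; inj₂)
open import Data.Unit using (tt)
open import Data.Empty using (⊥-elim)
open import Relation.Binary using (Rel; Decidable; DecidableEquality)
open import Relation.Binary.Construct.Closure.Transitive using (TransClosure) renaming ([_] to [_]⁺; _∷_ to _∷⁺_)
open import Relation.Nullary using (¬_; yes; no)
open import Relation.Nullary.Decidable using (map′; _×-dec_; _⊎-dec_)
open import Relation.Binary.PropositionalEquality using (_≡_; refl; sym)

-- Floyd–Warshall: `Via V` are the paths whose intermediate vertices all lie in V.
module FiniteReachability {a ℓ : Level} {A : Set a} (_↝_ : Rel A ℓ) where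

  data Via (V : List A) : Rel A (a ⊔ ℓ) where
    edge    : ∀ {x y} → x ↝ y → Via V x y
    through : ∀ {x y w} → x ↝ y → y ∈ V → Via V y w → Via V x w

  Via⇒⁺ : ∀ {V x y} → Via V x y → TransClosure _↝_ x y
  Via⇒⁺ (edge h)        = [ h ]⁺
  Via⇒⁺ (through h _ p) = h ∷⁺ Via⇒⁺ p

  ⁺⇒Via : ∀ {V} → (∀ v → v ∈ V) → ∀ {x y} → TransClosure _↝_ x y → Via V x y
  ⁺⇒Via all [ h ]⁺     = edge h
  ⁺⇒Via all (h ∷⁺ p) = through h (all _) (⁺⇒Via all p)

  Via-weaken : ∀ {v V x y} → Via V x y → Via (v ∷ₗ V) x y
  Via-weaken (edge h)        = edge h
  Via-weaken (through h m p) = through h (there m) (Via-weaken p)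

  Via-join : ∀ {v V x y} → Via V x v → Via V v y → Via (v ∷ₗ V) x y
  Via-join (edge h)        q = through h (here refl) (Via-weaken q)
  Via-join (through h m p) q = through h (there m) (Via-join p q)

  -- Cut the path at its first and last visit to v.
  Via-split : ∀ {v V x y} → Via (v ∷ₗ V) x y → Via V x y ⊎ (Via V x v × Via V v y)
  Via-split (edge h) = inj₁ (edge h)
  Via-split (through h (here refl) p) with Via-split p
  ... | inj₁ q       = inj₂ (edge h , q)
  ... | inj₂ (_ , q) = inj₂ (edge h , q)
  Via-split (through h (there m) p) with Via-split p
  ... | inj₁ q        = inj₁ (through h m q)
  ... | inj₂ (q , q′) = inj₂ (through h m q , q′)

  Via? : Decidable _↝_ → ∀ V → Decidable (Via V)
  Via? _↝?_ []ₗ x y with x ↝? y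
  ... | yes h = yes (edge h)
  ... | no ¬h = no λ { (edge h) → ¬h h ; (through _ () _) }
  Via? _↝?_ (v ∷ₗ V) x y =
    map′ join-or-weaken Via-split (Via? _↝?_ V x y ⊎-dec (Via? _↝?_ V x v ×-dec Via? _↝?_ V v y))
    where
    join-or-weaken : Via V x y ⊎ (Via V x v × Via V v y) → Via (v ∷ₗ V) x y
    join-or-weaken (inj₁ p)       = Via-weaken p
    join-or-weaken (inj₂ (p , q)) = Via-join p q

  TransClosure? : Decidable _↝_ → (V : List A) → (∀ v → v ∈ V) → Decidable (TransClosure _↝_)
  TransClosure? _↝?_ V all x y = map′ Via⇒⁺ (⁺⇒Via all) (Via? _↝?_ V x y)

Out-≟ : ∀ {n} (ms : Vec ℕ n) → DecidableEquality (Out ms)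
Out-≟ []       = λ _ _ → yes refl
Out-≟ (k ∷ ms) = ≡-dec Fin._≟_ (Out-≟ ms)

outcomes : ∀ {n} (ms : Vec ℕ n) → List (Out ms)
outcomes []       = tt ∷ₗ []ₗ
outcomes (k ∷ ms) = cartesianProduct (allFin k) (outcomes ms)

∈-outcomes : ∀ {n} (ms : Vec ℕ n) (x : Out ms) → x ∈ outcomes ms
∈-outcomes []       tt      = here refl
∈-outcomes (k ∷ ms) (a , x) = ∈-cartesianProduct⁺ (∈-allFin a) (∈-outcomes ms x)

module Components {n : ℕ} (ms : Vec ℕ n) (R : Out ms → Out ms → Bool) where
  open Rule ms R

  infixr 5 _◅◅_
  _◅◅_ : ∀ {a b c} → Reach a b → Reach b c → Reach a c
  arc h   ◅◅ q = h ◅ q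
  (h ◅ p) ◅◅ q = h ◅ (p ◅◅ q)

  Reach⇒⁺ : ∀ {a b} → Reach a b → TransClosure _≻_ a b
  Reach⇒⁺ (arc h) = [ h ]⁺
  Reach⇒⁺ (h ◅ p) = h ∷⁺ Reach⇒⁺ p

  ⁺⇒Reach : ∀ {a b} → TransClosure _≻_ a b → Reach a b
  ⁺⇒Reach [ h ]⁺    = arc h
  ⁺⇒Reach (h ∷⁺ p) = h ◅ ⁺⇒Reach p

  _≻?_ : Decidable _≻_
  x ≻? y = R x y ≟ true

  Reach? : Decidable Reach
  Reach? x y = map′ ⁺⇒Reach Reach⇒⁺
    (FiniteReachability.TransClosure? _≻_ _≻?_ (outcomes ms) (∈-outcomes ms) x y)

  SameComp? : Decidable SameComp
  SameComp? x y = Out-≟ ms x y ⊎-dec (Reach? x y ×-dec Reach? y x)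

  infix 4 _⇝_
  _⇝_ : X → X → Set
  a ⇝ b = a ≡ b ⊎ Reach a b

  ⇝-trans : ∀ {a b c} → a ⇝ b → b ⇝ c → a ⇝ c
  ⇝-trans (inj₁ refl) q           = q
  ⇝-trans (inj₂ p)    (inj₁ refl) = inj₂ p
  ⇝-trans (inj₂ p)    (inj₂ q)    = inj₂ (p ◅◅ q)

  SameComp⇒⇝ : ∀ {a b} → SameComp a b → a ⇝ b
  SameComp⇒⇝ (inj₁ e)       = inj₁ e
  SameComp⇒⇝ (inj₂ (p , _)) = inj₂ p

  SameComp⇒⇜ : ∀ {a b} → SameComp a b → b ⇝ a
  SameComp⇒⇜ (inj₁ e)       = inj₁ (sym e)
  SameComp⇒⇜ (inj₂ (_ , q)) = inj₂ q

  SameComp-trans : ∀ {a b c} → SameComp a b → SameComp b c → SameComp a c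
  SameComp-trans s t with ⇝-trans (SameComp⇒⇝ s) (SameComp⇒⇝ t) | ⇝-trans (SameComp⇒⇜ t) (SameComp⇒⇜ s)
  ... | inj₁ e | _      = inj₁ e
  ... | inj₂ _ | inj₁ e = inj₁ (sym e)
  ... | inj₂ p | inj₂ q = inj₂ (p , q)

  cycle⇒SameComp : ∀ {a b} → a ≻ b → b ⇝ a → SameComp a b
  cycle⇒SameComp _ (inj₁ e) = inj₁ (sym e)
  cycle⇒SameComp h (inj₂ p) = inj₂ (arc h , p)

  DomPath⇒⇜ : ∀ {A a b} → DomPath A a b → b ⇝ a
  DomPath⇒⇜ here                         = inj₁ refl
  DomPath⇒⇜ (step _ _ ((h , _) , _) p) = ⇝-trans (DomPath⇒⇜ p) (inj₂ (arc h))

  uLocalOpt-maximal : ∀ {z x} → ULocalOpt z → SameComp z x → ¬ NotMax x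
  uLocalOpt-maximal {x = x} uz s (w , ¬sw , dom) with uz w
  ... | _ , _ , _ , p = ¬sw (cycle⇒SameComp w≻x (⇝-trans (SameComp⇒⇜ s) (DomPath⇒⇜ p)))
    where
    w≻x : w ≻ x
    w≻x = dom w x (inj₁ refl) (inj₁ refl)

  prefix : ∀ {A x y w} {p : DomPath A x w} → OnPath y p → DomPath A x y
  prefix at-start                            = here
  prefix (later {I = I} {I∈ = I∈} {b = b} o) = step I I∈ b (prefix o)

  module Tournament (T : CompleteStrict) where
    open CompleteStrict T

    arc⇒Higher : ∀ {a b} → a ≻ b → ¬ SameComp a b → Higher a b
    arc⇒Higher {a} {b} h ¬s = ¬s , dominates
      where
      dominates : ∀ u v → SameComp u a → SameComp v b → u ≻ v
      dominates u v su sv with total u v (λ { refl → ¬s (cycle⇒SameComp h (⇝-trans (SameComp⇒⇜ sv) (SameComp⇒⇝ su))) })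
      ... | inj₁ u≻v = u≻v
      ... | inj₂ v≻u = ⊥-elim (¬s (cycle⇒SameComp h
              (⇝-trans (SameComp⇒⇜ sv) (⇝-trans (inj₂ (arc v≻u)) (SameComp⇒⇝ su)))))

    -- The outcome from which the path first leaves the component of x is lifting.
    lifting-on-exit : ∀ {A x c w} → ¬ SameComp w x → SameComp c x → (p : DomPath A c w)
                    → ∃ λ y → OnPath y p × SameComp y x × Lifting A y
    lifting-on-exit ¬sw s here = ⊥-elim (¬sw s)
    lifting-on-exit {x = x} ¬sw s (step {y = c′} I I∈ b p) with SameComp? c′ x
    ... | yes s′ with lifting-on-exit ¬sw s′ p
    ...   | y , o , sy , l = y , later o , sy , l
    lifting-on-exit {c = c} ¬sw s (step {y = c′} I I∈ b@((c′≻c , _) , _) p) | no ¬s′ =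
      c , at-start , s , I , I∈ , c′ , b , arc⇒Higher c′≻c (λ s″ → ¬s′ (SameComp-trans s″ s))

mainTheorem8 : ∀ {n : ℕ} (ms : Vec ℕ n) (R : Out ms → Out ms → Bool)
    → 1 ≤ n → (∀ (i : Fin n) → 1 ≤ lookup ms i)
    → Rule.CompleteStrict ms R
    → (z : Out ms) → Rule.ULocalOpt ms R z
    → (∀ (x : Out ms) → Rule.NotMax ms R x
         → ∃ λ (A : List (Object n)) → IsScheme A × Rule.LocalOpt ms R A z
             × ∃ λ (y : Out ms) → Rule.DomPath ms R A x y × Rule.SameComp ms R y x × Rule.Lifting ms R A y)
      × (∀ (x : Out ms) → Rule.NotMax ms R x
         → ∀ (A : List (Object n)) → IsScheme A → Rule.LocalOpt ms R A z
         → (p : Rule.DomPath ms R A x z)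
         → ∃ λ (y : Out ms) → Rule.OnPath ms R y p × Rule.SameComp ms R y x × Rule.Lifting ms R A y)
      × (∀ (x : Out ms) → Rule.NotMax ms R x
         → ∃ λ (y : Out ms) → Rule.SameComp ms R y x
             × ∃ λ (A : List (Object n)) → IsScheme A × Rule.LocalOpt ms R A z × Rule.Lifting ms R A y)
mainTheorem8 ms R _ _ T z uz = part-i , part-ii , part-iii
  where
  open Rule ms R
  open Components ms R
  open Tournament T

  part-ii : ∀ x → NotMax x → ∀ A → IsScheme A → LocalOpt A z → (p : DomPath A x z)
          → ∃ λ y → OnPath y p × SameComp y x × Lifting A y
  part-ii x nm _ _ _ p = lifting-on-exit (λ s → uLocalOpt-maximal uz s nm) (inj₁ refl) p

  part-i : ∀ x → NotMax x → ∃ λ A → IsScheme A × LocalOpt A z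
             × ∃ λ y → DomPath A x y × SameComp y x × Lifting A y
  part-i x nm with uz x
  ... | A , sch , lo , p with part-ii x nm A sch lo p
  ...   | y , o , sy , l = A , sch , lo , y , prefix o , sy , l

  part-iii : ∀ x → NotMax x → ∃ λ y → SameComp y x × ∃ λ A → IsScheme A × LocalOpt A z × Lifting A y
  part-iii x nm with part-i x nm
  ... | A , sch , lo , y , _ , sy , l = y , sy , A , sch , lo , l
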